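{- Let $q$ be a prime power and $k \ge 0$ an integer. Let $M$ be a matroid and $C \subseteq E(M)$, and suppose $M$ has a restriction $S$ that is a $(q, k(r_M(C)+1))$-stack. Then $(M / C)|(E(S) \setminus C)$ has a restriction that is a $(q,k)$-stack.
   Context: All matroids are finite. For a prime power $q$ and nonnegative integers $h,t$, a matroid $S$ is a $(q,h,t)$-stack if there are pairwise disjoint subsets $F_1,\dots,F_h$ of $E(S)$ whose union is spanning in $S$, such that for each $i \in \{1,\dots,h\}$ the matroid $(S/(F_1 \cup \dots \cup F_{i-1}))|F_i$ has rank at most $t$ and is not $\mathrm{GF}(q)$-representable. A $(q,h)$-stack is a matroid that is a $(q,h,t)$-stack for some nonnegative integer $t$. A stack restriction of $M$ is a restriction $M|Z$ ($Z \subseteq E(M)$) that is a stack. $r_M$ is the rank function of $M$. -}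

module Defs where

open import Data.Nat using (ℕ; zero; suc; _≤_; _∸_; _+_; _*_; _^_)
open import Data.Nat.Primality using (Prime)
open import Data.Fin using (Fin; zero; suc; toℕ)
open import Data.Fin.Subset using (Subset; ⊥; _∪_; _∩_; _∈_; _∉_; _⊆_; ∣_∣)
open import Data.Product using (Σ; ∃; _×_; _,_)
open import Relation.Binary.PropositionalEquality using (_≡_; _≢_)
open import Relation.Nullary using (¬_)
open import Algebra.Structures using (IsCommutativeRing)
open import Function using (_∘_)

IsPrimePower : ℕ → Set
IsPrimePower q = Σ ℕ λ p → Σ ℕ λ k → Prime p × q ≡ p ^ suc k

record Matroid (n : ℕ) : Set where
  field
    rank       : Subset n → ℕ
    rank-≤card : ∀ X → rank X ≤ ∣ X ∣
    rank-mono  : ∀ {X Y} → X ⊆ Y → rank X ≤ rank Y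
    rank-submod : ∀ X Y → rank (X ∪ Y) + rank (X ∩ Y) ≤ rank X + rank Y
open Matroid public

-- A minor (M / C) | Z (with Z ∩ C = ∅ in all uses below) is described
-- by the pair (C , Z).  Its rank function on subsets Y ⊆ Z is
--   r_{M/C}(Y) = r_M(Y ∪ C) - r_M(C).
minorRank : ∀ {n} → Matroid n → Subset n → Subset n → ℕ
minorRank M C Y = rank M (Y ∪ C) ∸ rank M C

-- Finite fields of order q: a field structure on the carrier Fin q.
-- (All fields of order q are isomorphic to GF(q).)

record FieldOn (q : ℕ) : Set where
  field
    _+F_ _*F_ : Fin q → Fin q → Fin q
    -F_       : Fin q → Fin q
    0F 1F     : Fin q
    isCommRing : IsCommutativeRing _≡_ _+F_ _*F_ -F_ 0F 1F
    0≢1       : 0F ≢ 1F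
    inverse   : ∀ x → x ≢ 0F → Σ (Fin q) λ y → x *F y ≡ 1F
open FieldOn public

sumF : ∀ {q} (F : FieldOn q) {n : ℕ} → (Fin n → Fin q) → Fin q
sumF F {zero}  f = 0F F
sumF F {suc n} f = _+F_ F (f zero) (sumF F (f ∘ suc))

LinIndep : ∀ {q} (F : FieldOn q) {n d : ℕ} →
           (Fin n → Fin d → Fin q) → Subset n → Set
LinIndep F {n} {d} v Y =
  ∀ (c : Fin n → Fin _) →
    (∀ i → i ∉ Y → c i ≡ 0F F) →
    (∀ (j : Fin d) → sumF F (λ i → _*F_ F (c i) (v i j)) ≡ 0F F) →
    ∀ i → c i ≡ 0F F

Representable : ∀ {n} (q : ℕ) → Matroid n → Subset n → Subset n → Set
Representable {n} q M C X =
  Σ (FieldOn q) λ F → Σ ℕ λ d → Σ (Fin n → Fin d → Fin q) λ v →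
    ∀ Y → Y ⊆ X →
      (minorRank M C Y ≡ ∣ Y ∣ → LinIndep F v Y) ×
      (LinIndep F v Y → minorRank M C Y ≡ ∣ Y ∣)

-- unionUpTo F i = F 0 ∪ … ∪ F (i-1)
unionUpTo : ∀ {n h} → (Fin h → Subset n) → ℕ → Subset n
unionUpTo {h = zero}  F i       = ⊥
unionUpTo {h = suc h} F zero    = ⊥
unionUpTo {h = suc h} F (suc i) = F zero ∪ unionUpTo (F ∘ suc) i

IsStackT : ∀ {n} → ℕ → ℕ → ℕ → Matroid n → Subset n → Subset n → Set
IsStackT {n} q h t M C Z =
  Σ (Fin h → Subset n) λ F →
    (∀ i → F i ⊆ Z) ×
    (∀ i j → i ≢ j → F i ∩ F j ≡ ⊥) ×
    -- the union F_1 ∪ … ∪ F_h is spanning in S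
    (minorRank M C (unionUpTo F h) ≡ minorRank M C Z) ×
    -- (S / (F_1 ∪ … ∪ F_{i-1})) | F_i = (M / (C ∪ F_<i)) | F_i
    (∀ i → minorRank M (C ∪ unionUpTo F (toℕ i)) (F i) ≤ t ×
           ¬ Representable q M (C ∪ unionUpTo F (toℕ i)) (F i))

IsStack : ∀ {n} → ℕ → ℕ → Matroid n → Subset n → Subset n → Set
IsStack q h M C Z = ∃ λ t → IsStackT q h t M C Z

-- Let P j be the union of the first j blocks of the stack and D j the rank of C in M / P j.
-- D is non-increasing with D 0 ≤ r(C), so among any r(C) + 1 consecutive blocks there is one,
-- F m, at which D stalls: D (m + 1) = D m.  Then C is skew to F m in M / P m, so
-- (M / (C ∪ P m)) | F m = (M / P m) | F m is not representable.  Since representability is closed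
-- under minors, neither is (M / (C ∪ P ℓ)) | (P (m + 1) − (C ∪ P ℓ)) for any earlier cut ℓ.
-- Cutting the stack greedily at stalls yields k such pieces, which form a (q, k)-stack in M / C.

module Submission where

open import Defs
open import Data.Nat using (ℕ; zero; suc)
open import Data.Fin using (Fin; zero; suc; toℕ; fromℕ<)
open import Data.Fin.Properties using (all?; ¬∀⟶∃¬; toℕ<n; toℕ-fromℕ<) renaming (_≟_ to _≟ᶠ_)
open import Data.Fin.Subset using (Subset; ⊥; _⊆_; _⊂_; _─_; _-_; _∈_; _∉_; _∪_; _∩_; ⁅_⁆; ∣_∣; inside; outside)
open import Data.Fin.Subset.Properties
  using (x∈p∪q⁺; x∈p∪q⁻; x∈⁅x⁆; x∈⁅y⁆⇒x≡y; _∈?_; p⊆p∪q; q⊆p∪q; x∈p∩q⁺; x∈p∩q⁻; x∈p∧x∉q⇒x∈p─q;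
         x∈p∧x≢y⇒x∈p-y; p─q⊆p; ⊆-antisym; ∪-assoc; ∪-comm; ∪-identityˡ; ∪-identityʳ; ∣⁅x⁆∣≡1;
         x∈p⇒∣p-x∣<∣p∣; x∈p⇒p-x⊂p; nonempty?; Empty-unique; ∉⊥; ∣p∣≤n)
open import Data.Fin.Subset.Induction using (⊂-wellFounded; Acc; acc)
open import Data.Product using (Σ; _×_; _,_; proj₁; proj₂)
import Data.Product as Product
open import Data.Sum using (inj₁; inj₂; [_,_]′)
open import Data.Vec.Base using (_∷_; here; there)
open import Data.Vec.Functional using (Vector)
open import Function using (_∘_; id)
open import Level using (0ℓ)
open import Algebra.Bundles using (CommutativeRing)
import Algebra.Properties.Ring as RingProperties
import Algebra.Properties.Semiring.Sum as SemiringSum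
open import Relation.Binary.PropositionalEquality
open import Relation.Nullary using (¬_; yes; no; contradiction)

module FieldLinearAlgebra {q : ℕ} (F : FieldOn q) where

  commutativeRing : CommutativeRing 0ℓ 0ℓ
  commutativeRing = record { isCommutativeRing = isCommRing F }

  open CommutativeRing commutativeRing public
    using (_+_; _*_; -_; 0#; 1#; +-identityˡ; +-identityʳ; *-identityˡ; *-identityʳ;
           *-assoc; distribˡ; distribʳ; zeroˡ; zeroʳ; -‿inverseʳ)
  open CommutativeRing commutativeRing using (ring; semiring)
  open RingProperties ring using (-‿distribˡ-*; -‿distribʳ-*; -‿involutive; -0#≈0#)
  open SemiringSum semiring using (sum; ∑-distrib-+; *-distribʳ-sum; sum-replicate-zero)
  open ≡-Reasoning

  ∑ : ∀ {n} → Vector (Fin q) n → Fin q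
  ∑ = sumF F

  ∑≡sum : ∀ {n} (f : Vector (Fin q) n) → ∑ f ≡ sum f
  ∑≡sum {zero}  f = refl
  ∑≡sum {suc n} f = cong (f zero +_) (∑≡sum (f ∘ suc))

  ∑-cong : ∀ {n} {f g : Vector (Fin q) n} → (∀ i → f i ≡ g i) → ∑ f ≡ ∑ g
  ∑-cong {zero}  f≗g = refl
  ∑-cong {suc n} f≗g = cong₂ _+_ (f≗g zero) (∑-cong (f≗g ∘ suc))

  ∑-zero : ∀ n → ∑ {n} (λ _ → 0#) ≡ 0#
  ∑-zero n = trans (∑≡sum {n} _) (sum-replicate-zero n)

  ∑-+ : ∀ {n} (f g : Vector (Fin q) n) → ∑ (λ i → f i + g i) ≡ ∑ f + ∑ g
  ∑-+ f g = begin
    ∑ (λ i → f i + g i)  ≡⟨ ∑≡sum (λ i → f i + g i) ⟩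
    sum (λ i → f i + g i) ≡⟨ ∑-distrib-+ f g ⟩
    sum f + sum g         ≡⟨ sym (cong₂ _+_ (∑≡sum f) (∑≡sum g)) ⟩
    ∑ f + ∑ g             ∎

  ∑-*ʳ : ∀ {n} (f : Vector (Fin q) n) a → ∑ (λ i → f i * a) ≡ ∑ f * a
  ∑-*ʳ f a = begin
    ∑ (λ i → f i * a)  ≡⟨ ∑≡sum (λ i → f i * a) ⟩
    sum (λ i → f i * a) ≡⟨ sym (*-distribʳ-sum a f) ⟩
    sum f * a           ≡⟨ cong (_* a) (sym (∑≡sum f)) ⟩
    ∑ f * a             ∎

  δ : ∀ {n} → Fin n → Vector (Fin q) n
  δ zero    zero    = 1#
  δ zero    (suc _) = 0#
  δ (suc _) zero    = 0#
  δ (suc e) (suc i) = δ e i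

  δ-diag : ∀ {n} (e : Fin n) → δ e e ≡ 1#
  δ-diag zero    = refl
  δ-diag (suc e) = δ-diag e

  δ-offdiag : ∀ {n} (e i : Fin n) → i ≢ e → δ e i ≡ 0#
  δ-offdiag zero    zero    i≢e = contradiction refl i≢e
  δ-offdiag zero    (suc i) _   = refl
  δ-offdiag (suc e) zero    _   = refl
  δ-offdiag (suc e) (suc i) i≢e = δ-offdiag e i (i≢e ∘ cong suc)

  ∑-δ : ∀ {n} (e : Fin n) (f : Vector (Fin q) n) → ∑ (λ i → δ e i * f i) ≡ f e
  ∑-δ {suc n} zero f = begin
    1# * f zero + ∑ (λ i → 0# * f (suc i)) ≡⟨ cong₂ _+_ (*-identityˡ _) (∑-cong (λ i → zeroˡ (f (suc i)))) ⟩
    f zero + ∑ {n} (λ _ → 0#)              ≡⟨ cong (f zero +_) (∑-zero n) ⟩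
    f zero + 0#                            ≡⟨ +-identityʳ _ ⟩
    f zero                                 ∎
  ∑-δ {suc n} (suc e) f = begin
    0# * f zero + ∑ (λ i → δ e i * f (suc i)) ≡⟨ cong₂ _+_ (zeroˡ _) (∑-δ e (f ∘ suc)) ⟩
    0# + f (suc e)                            ≡⟨ +-identityˡ _ ⟩
    f (suc e)                                 ∎

  addAt : ∀ {n} → Vector (Fin q) n → Fin n → Fin q → Vector (Fin q) n
  addAt c e a i = c i + δ e i * a

  addAt-diag : ∀ {n} (c : Vector (Fin q) n) e a → addAt c e a e ≡ c e + a
  addAt-diag c e a = trans (cong (λ x → c e + x * a) (δ-diag e)) (cong (c e +_) (*-identityˡ a))

  addAt-offdiag : ∀ {n} (c : Vector (Fin q) n) e a i → i ≢ e → addAt c e a i ≡ c i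
  addAt-offdiag c e a i i≢e = begin
    c i + δ e i * a ≡⟨ cong (λ x → c i + x * a) (δ-offdiag e i i≢e) ⟩
    c i + 0# * a    ≡⟨ cong (c i +_) (zeroˡ a) ⟩
    c i + 0#        ≡⟨ +-identityʳ (c i) ⟩
    c i             ∎

  ∑-addAt : ∀ {n} (c : Vector (Fin q) n) e a (f : Vector (Fin q) n) →
            ∑ (λ i → addAt c e a i * f i) ≡ ∑ (λ i → c i * f i) + a * f e
  ∑-addAt c e a f = begin
    ∑ (λ i → (c i + δ e i * a) * f i)
      ≡⟨ ∑-cong (λ i → trans (distribʳ (f i) (c i) _) (cong (c i * f i +_) (*-assoc (δ e i) a (f i)))) ⟩
    ∑ (λ i → c i * f i + δ e i * (a * f i))
      ≡⟨ ∑-+ (λ i → c i * f i) (λ i → δ e i * (a * f i)) ⟩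
    ∑ (λ i → c i * f i) + ∑ (λ i → δ e i * (a * f i))
      ≡⟨ cong (∑ (λ i → c i * f i) +_) (∑-δ e (λ i → a * f i)) ⟩
    ∑ (λ i → c i * f i) + a * f e ∎

  ¬linIndep-zero : ∀ {n d} (v : Fin n → Fin d → Fin q) {Y e} →
                   e ∈ Y → (∀ j → v e j ≡ 0#) → ¬ LinIndep F v Y
  ¬linIndep-zero v {Y} {e} e∈Y vₑ≡0 v-indep = 0≢1 F (begin
    0#    ≡⟨ sym (v-indep (δ e) δ-supp ∑δv≡0 e) ⟩
    δ e e ≡⟨ δ-diag e ⟩
    1#    ∎)
    where
    δ-supp : ∀ i → i ∉ Y → δ e i ≡ 0#
    δ-supp i i∉Y = δ-offdiag e i (λ { refl → i∉Y e∈Y })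
    ∑δv≡0 : ∀ j → ∑ (λ i → δ e i * v i j) ≡ 0#
    ∑δv≡0 j = trans (∑-δ e (λ i → v i j)) (vₑ≡0 j)

  linIndep⇒nonzero : ∀ {n d} (v : Fin n → Fin d → Fin q) {Y e} →
                     e ∈ Y → LinIndep F v Y → Σ (Fin d) λ j → v e j ≢ 0#
  linIndep⇒nonzero {d = d} v {e = e} e∈Y v-indep with all? (λ j → v e j ≟ᶠ 0#)
  ... | yes vₑ≡0  = contradiction v-indep (¬linIndep-zero v e∈Y vₑ≡0)
  ... | no  ¬vₑ≡0 = ¬∀⟶∃¬ d _ (λ j → v e j ≟ᶠ 0#) ¬vₑ≡0

  linIndep-cong : ∀ {n d} {v w : Fin n → Fin d → Fin q} {Y} →
                  (∀ i → i ∈ Y → ∀ j → v i j ≡ w i j) → LinIndep F v Y → LinIndep F w Y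
  linIndep-cong {v = v} {w} {Y} v≗w v-indep c c-supp ∑cw≡0 =
    v-indep c c-supp (λ j → trans (∑-cong (cv≡cw j)) (∑cw≡0 j))
    where
    vanishes : ∀ {i} → i ∉ Y → ∀ x → c i * x ≡ 0#
    vanishes i∉Y x = trans (cong (_* x) (c-supp _ i∉Y)) (zeroˡ x)
    cv≡cw : ∀ j i → c i * v i j ≡ c i * w i j
    cv≡cw j i with i ∈? Y
    ... | yes i∈Y = cong (c i *_) (v≗w i i∈Y j)
    ... | no  i∉Y = trans (vanishes i∉Y (v i j)) (sym (vanishes i∉Y (w i j)))

  -- Gaussian elimination on the pivot entry v e j₀: reduced i = v i − (v i j₀ / v e j₀) v e
  -- represents the contraction of e.
  module Pivot {n d} (v : Fin n → Fin d → Fin q) (e : Fin n) (j₀ : Fin d)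
               (p : Fin q) (vₑⱼ₀*p≡1 : v e j₀ * p ≡ 1#) where

    ratio : Fin n → Fin q
    ratio i = v i j₀ * p

    reduced : Fin n → Fin d → Fin q
    reduced i j = v i j + ratio i * (- v e j)

    reduced-pivot≡0 : ∀ j → reduced e j ≡ 0#
    reduced-pivot≡0 j = begin
      v e j + (v e j₀ * p) * (- v e j) ≡⟨ cong (λ x → v e j + x * (- v e j)) vₑⱼ₀*p≡1 ⟩
      v e j + 1# * (- v e j)           ≡⟨ cong (v e j +_) (*-identityˡ _) ⟩
      v e j + (- v e j)                ≡⟨ -‿inverseʳ (v e j) ⟩
      0#                               ∎

    ∑-reduced : ∀ (c : Vector (Fin q) n) j →
      ∑ (λ i → c i * reduced i j) ≡ ∑ (λ i → c i * v i j) + ∑ (λ i → c i * ratio i) * (- v e j)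
    ∑-reduced c j = begin
      ∑ (λ i → c i * reduced i j)
        ≡⟨ ∑-cong (λ i → trans (distribˡ (c i) (v i j) _) (cong (c i * v i j +_) (sym (*-assoc (c i) (ratio i) _)))) ⟩
      ∑ (λ i → c i * v i j + (c i * ratio i) * (- v e j))
        ≡⟨ ∑-+ (λ i → c i * v i j) (λ i → (c i * ratio i) * (- v e j)) ⟩
      ∑ (λ i → c i * v i j) + ∑ (λ i → (c i * ratio i) * (- v e j))
        ≡⟨ cong (∑ (λ i → c i * v i j) +_) (∑-*ʳ (λ i → c i * ratio i) (- v e j)) ⟩
      ∑ (λ i → c i * v i j) + ∑ (λ i → c i * ratio i) * (- v e j) ∎

    ∑-ratio : ∀ (c : Vector (Fin q) n) → ∑ (λ i → c i * ratio i) ≡ ∑ (λ i → c i * v i j₀) * p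
    ∑-ratio c = trans (∑-cong (λ i → sym (*-assoc (c i) (v i j₀) p))) (∑-*ʳ (λ i → c i * v i j₀) p)

    linIndep-reduced : ∀ {Y} → e ∉ Y → LinIndep F v (Y ∪ ⁅ e ⁆) → LinIndep F reduced Y
    linIndep-reduced {Y} e∉Y v-indep c c-supp ∑cw≡0 = c≡0
      where
      s = ∑ (λ i → c i * ratio i)
      c′ = addAt c e (- s)
      c′-supp : ∀ i → i ∉ Y ∪ ⁅ e ⁆ → c′ i ≡ 0#
      c′-supp i i∉ = trans (addAt-offdiag c e (- s) i i≢e) (c-supp i (i∉ ∘ x∈p∪q⁺ ∘ inj₁))
        where
        i≢e : i ≢ e
        i≢e refl = i∉ (x∈p∪q⁺ (inj₂ (x∈⁅x⁆ e)))
      ∑c′v≡0 : ∀ j → ∑ (λ i → c′ i * v i j) ≡ 0#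
      ∑c′v≡0 j = begin
        ∑ (λ i → c′ i * v i j)                  ≡⟨ ∑-addAt c e (- s) (λ i → v i j) ⟩
        ∑ (λ i → c i * v i j) + (- s) * v e j   ≡⟨ cong (∑ (λ i → c i * v i j) +_)
                                                      (trans (sym (-‿distribˡ-* s (v e j))) (-‿distribʳ-* s (v e j))) ⟩
        ∑ (λ i → c i * v i j) + s * (- v e j)   ≡⟨ sym (∑-reduced c j) ⟩
        ∑ (λ i → c i * reduced i j)             ≡⟨ ∑cw≡0 j ⟩
        0#                                      ∎
      c≡0 : ∀ i → c i ≡ 0#
      c≡0 i with i ≟ᶠ e
      ... | yes refl = c-supp e e∉Y
      ... | no  i≢e  = trans (sym (addAt-offdiag c e (- s) i i≢e)) (v-indep c′ c′-supp ∑c′v≡0 i)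

    linIndep-unreduced : ∀ {Y} → e ∉ Y → LinIndep F reduced Y → LinIndep F v (Y ∪ ⁅ e ⁆)
    linIndep-unreduced {Y} e∉Y w-indep c c-supp ∑cv≡0 = c≡0
      where
      a = - c e
      c′ = addAt c e a
      c′-supp : ∀ i → i ∉ Y → c′ i ≡ 0#
      c′-supp i i∉Y with i ≟ᶠ e
      ... | yes refl = trans (addAt-diag c e a) (-‿inverseʳ (c e))
      ... | no  i≢e  = trans (addAt-offdiag c e a i i≢e)
                             (c-supp i (λ i∈ → [ i∉Y , i≢e ∘ x∈⁅y⁆⇒x≡y e ]′ (x∈p∪q⁻ Y ⁅ e ⁆ i∈)))
      ∑c′v : ∀ j → ∑ (λ i → c′ i * v i j) ≡ a * v e j
      ∑c′v j = trans (∑-addAt c e a (λ i → v i j)) (trans (cong (_+ a * v e j) (∑cv≡0 j)) (+-identityˡ _))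
      ∑c′ratio : ∑ (λ i → c′ i * ratio i) ≡ a
      ∑c′ratio = begin
        ∑ (λ i → c′ i * ratio i) ≡⟨ ∑-ratio c′ ⟩
        ∑ (λ i → c′ i * v i j₀) * p ≡⟨ cong (_* p) (∑c′v j₀) ⟩
        (a * v e j₀) * p ≡⟨ *-assoc a _ p ⟩
        a * (v e j₀ * p) ≡⟨ cong (a *_) vₑⱼ₀*p≡1 ⟩
        a * 1# ≡⟨ *-identityʳ a ⟩
        a ∎
      ∑c′w≡0 : ∀ j → ∑ (λ i → c′ i * reduced i j) ≡ 0#
      ∑c′w≡0 j = begin
        ∑ (λ i → c′ i * reduced i j)              ≡⟨ ∑-reduced c′ j ⟩
        ∑ (λ i → c′ i * v i j) + ∑ (λ i → c′ i * ratio i) * (- v e j)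
                                                  ≡⟨ cong₂ (λ x y → x + y * (- v e j)) (∑c′v j) ∑c′ratio ⟩
        a * v e j + a * (- v e j)                 ≡⟨ sym (distribˡ a _ _) ⟩
        a * (v e j + (- v e j))                   ≡⟨ cong (a *_) (-‿inverseʳ (v e j)) ⟩
        a * 0#                                    ≡⟨ zeroʳ a ⟩
        0#                                        ∎
      c′≡0 : ∀ i → c′ i ≡ 0#
      c′≡0 = w-indep c′ c′-supp ∑c′w≡0
      a≡0 : a ≡ 0#
      a≡0 = begin
        a                        ≡⟨ sym ∑c′ratio ⟩
        ∑ (λ i → c′ i * ratio i) ≡⟨ ∑-cong (λ i → trans (cong (_* ratio i) (c′≡0 i)) (zeroˡ (ratio i))) ⟩
        ∑ {n} (λ _ → 0#)         ≡⟨ ∑-zero n ⟩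
        0#                       ∎
      c≡0 : ∀ i → c i ≡ 0#
      c≡0 i with i ≟ᶠ e
      ... | yes refl = trans (sym (-‿involutive (c e))) (trans (cong -_ a≡0) -0#≈0#)
      ... | no  i≢e  = trans (sym (addAt-offdiag c e a i i≢e)) (c′≡0 i)

open import Data.Nat using (_+_; _*_; _∸_; _≤_; _<_; s≤s; z≤n)
open import Data.Nat.Solver using (module +-*-Solver)
open +-*-Solver using (solve; _:+_; _:=_)
open import Data.Nat.Properties
  using (≤-refl; ≤-trans; ≤-reflexive; ≤-antisym; m≤m+n; +-mono-≤; +-monoˡ-≤; +-comm;
         +-cancelʳ-≤; +-suc; +-assoc; *-monoʳ-≤; <-≤-trans; ≤∧≢⇒<; ≤-pred; n≤1+n; <⇒≢; suc-injective;
         m≤n⇒m<n∨m≡n; m∸n≤m; m≤n+o⇒m∸n≤o; m+n∸n≡m; m∸n+n≡m; [m+n]∸[m+o]≡n∸o)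
  renaming (_≟_ to _≟ℕ_)

∪-least : ∀ {n} {A B C : Subset n} → A ⊆ C → B ⊆ C → A ∪ B ⊆ C
∪-least {A = A} {B} A⊆C B⊆C x∈A∪B = [ A⊆C , B⊆C ]′ (x∈p∪q⁻ A B x∈A∪B)

∣p∪⁅x⁆∣≡1+∣p∣ : ∀ {n} (x : Fin n) (p : Subset n) → x ∉ p → ∣ p ∪ ⁅ x ⁆ ∣ ≡ suc ∣ p ∣
∣p∪⁅x⁆∣≡1+∣p∣ zero    (outside ∷ p) _   = cong (suc ∘ ∣_∣) (∪-identityʳ p)
∣p∪⁅x⁆∣≡1+∣p∣ zero    (inside  ∷ p) x∉p = contradiction here x∉p
∣p∪⁅x⁆∣≡1+∣p∣ (suc x) (outside ∷ p) x∉p = ∣p∪⁅x⁆∣≡1+∣p∣ x p (x∉p ∘ there)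
∣p∪⁅x⁆∣≡1+∣p∣ (suc x) (inside  ∷ p) x∉p = cong suc (∣p∪⁅x⁆∣≡1+∣p∣ x p (x∉p ∘ there))

⁅x⁆⊆p : ∀ {n} {x : Fin n} {p : Subset n} → x ∈ p → ⁅ x ⁆ ⊆ p
⁅x⁆⊆p {x = x} {p} x∈p y∈⁅x⁆ = subst (_∈ p) (sym (x∈⁅y⁆⇒x≡y x y∈⁅x⁆)) x∈p

[p-x]∪⁅x⁆≡p : ∀ {n} {x : Fin n} {p : Subset n} → x ∈ p → (p - x) ∪ ⁅ x ⁆ ≡ p
[p-x]∪⁅x⁆≡p {x = x} {p} x∈p = ⊆-antisym (∪-least (p─q⊆p p ⁅ x ⁆) (⁅x⁆⊆p x∈p)) p⊆
  where
  p⊆ : p ⊆ (p - x) ∪ ⁅ x ⁆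
  p⊆ {y} y∈p with y ≟ᶠ x
  ... | yes refl = q⊆p∪q _ _ (x∈⁅x⁆ x)
  ... | no  y≢x  = p⊆p∪q _ (x∈p∧x≢y⇒x∈p-y y∈p y≢x)

∪⁅⁆-induction : ∀ {n ℓ} (P : Subset n → Set ℓ) → P ⊥ → (∀ S x → P S → P (S ∪ ⁅ x ⁆)) → ∀ B → P B
∪⁅⁆-induction P P⊥ P∪⁅⁆ B = go B (⊂-wellFounded B)
  where
  go : ∀ B → Acc _⊂_ B → P B
  go B (acc smaller) with nonempty? B
  ... | no  B-empty     = subst P (sym (Empty-unique B-empty)) P⊥
  ... | yes (x , x∈B) = subst P ([p-x]∪⁅x⁆≡p x∈B) (P∪⁅⁆ (B - x) x (go (B - x) (smaller (x∈p⇒p-x⊂p x∈B))))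

x∈p─q⇒x∉q : ∀ {n} (p q : Subset n) {x} → x ∈ p ─ q → x ∉ q
x∈p─q⇒x∉q (_ ∷ p) (inside  ∷ q) {zero}  ()        _
x∈p─q⇒x∉q (_ ∷ p) (outside ∷ q) {zero}  _         ()
x∈p─q⇒x∉q (_ ∷ p) (_       ∷ q) {suc x} (there x∈) (there x∈q) = x∈p─q⇒x∉q p q x∈ x∈q

─-mono : ∀ {n} {p p′ q q′ : Subset n} → p ⊆ p′ → q′ ⊆ q → p ─ q ⊆ p′ ─ q′
─-mono {p = p} {q = q} p⊆p′ q′⊆q x∈ = x∈p∧x∉q⇒x∈p─q (p⊆p′ (p─q⊆p p q x∈)) (x∈p─q⇒x∉q p q x∈ ∘ q′⊆q)

disjoint⇒∩≡⊥ : ∀ {n} {p q : Subset n} → (∀ {x} → x ∈ p → x ∉ q) → p ∩ q ≡ ⊥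
disjoint⇒∩≡⊥ {p = p} {q} apart = Empty-unique λ { (x , x∈p∩q) →
  apart (proj₁ (x∈p∩q⁻ p q x∈p∩q)) (proj₂ (x∈p∩q⁻ p q x∈p∩q)) }

∈-unionUpTo⁻ : ∀ {n h} (F : Fin h → Subset n) j {x} → x ∈ unionUpTo F j →
               Σ (Fin h) λ i → toℕ i < j × x ∈ F i
∈-unionUpTo⁻ {h = zero}  F j       x∈ = contradiction x∈ ∉⊥
∈-unionUpTo⁻ {h = suc h} F zero    x∈ = contradiction x∈ ∉⊥
∈-unionUpTo⁻ {h = suc h} F (suc j) x∈ with x∈p∪q⁻ (F zero) _ x∈
... | inj₁ x∈F₀ = zero , s≤s z≤n , x∈F₀
... | inj₂ x∈U with ∈-unionUpTo⁻ (F ∘ suc) j x∈U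
...   | i , i<j , x∈Fᵢ = suc i , s≤s i<j , x∈Fᵢ

∈-unionUpTo⁺ : ∀ {n h} (F : Fin h → Subset n) j (i : Fin h) → toℕ i < j → F i ⊆ unionUpTo F j
∈-unionUpTo⁺ {h = suc h} F (suc j) zero    _         x∈ = x∈p∪q⁺ (inj₁ x∈)
∈-unionUpTo⁺ {h = suc h} F (suc j) (suc i) (s≤s i<j) x∈ = x∈p∪q⁺ (inj₂ (∈-unionUpTo⁺ (F ∘ suc) j i i<j x∈))

unionUpTo-zero : ∀ {n h} (F : Fin h → Subset n) → unionUpTo F 0 ≡ ⊥
unionUpTo-zero {h = zero}  F = refl
unionUpTo-zero {h = suc h} F = refl

unionUpTo-mono : ∀ {n h} (F : Fin h → Subset n) {j j′} → j ≤ j′ → unionUpTo F j ⊆ unionUpTo F j′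
unionUpTo-mono F {j} j≤j′ x∈ with ∈-unionUpTo⁻ F j x∈
... | i , i<j , x∈Fᵢ = ∈-unionUpTo⁺ F _ i (<-≤-trans i<j j≤j′) x∈Fᵢ

m∸n≡1+[m∸1+n] : ∀ m n → n < m → m ∸ n ≡ suc (m ∸ suc n)
m∸n≡1+[m∸1+n] (suc m) zero    _         = refl
m∸n≡1+[m∸1+n] (suc m) (suc n) (s≤s n<m) = m∸n≡1+[m∸1+n] m n n<m

-- A non-increasing sequence of naturals cannot strictly decrease D ℓ + 1 times in a row.
antitone-stalls : (D : ℕ → ℕ) → (∀ j → D (suc j) ≤ D j) →
                  ∀ ℓ → Σ ℕ λ m → ℓ ≤ m × m ≤ ℓ + D ℓ × D (suc m) ≡ D m
antitone-stalls D D-step ℓ = search (D ℓ) ℓ ≤-refl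
  where
  search : ∀ s ℓ → D ℓ ≤ s → Σ ℕ λ m → ℓ ≤ m × m ≤ ℓ + s × D (suc m) ≡ D m
  search s ℓ Dℓ≤s with D (suc ℓ) ≟ℕ D ℓ
  ... | yes stall = ℓ , ≤-refl , m≤m+n ℓ s , stall
  search zero    ℓ Dℓ≤0   | no drop = contradiction (<-≤-trans (≤∧≢⇒< (D-step ℓ) drop) Dℓ≤0) λ ()
  search (suc s) ℓ Dℓ≤1+s | no drop with search s (suc ℓ) (≤-pred (<-≤-trans (≤∧≢⇒< (D-step ℓ) drop) Dℓ≤1+s))
  ... | m , 1+ℓ≤m , m≤1+ℓ+s , stall =
    m , ≤-trans (n≤1+n ℓ) 1+ℓ≤m , ≤-trans m≤1+ℓ+s (≤-reflexive (sym (+-suc ℓ s))) , stall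

module MatroidRank {n} (M : Matroid n) where

  r : Subset n → ℕ
  r = rank M

  rank-∪≤ : ∀ X Y → r (X ∪ Y) ≤ r X + r Y
  rank-∪≤ X Y = ≤-trans (m≤m+n _ _) (rank-submod M X Y)

  rank-∪⁅⁆≤ : ∀ A e → r (A ∪ ⁅ e ⁆) ≤ suc (r A)
  rank-∪⁅⁆≤ A e = begin
    r (A ∪ ⁅ e ⁆)   ≤⟨ rank-∪≤ A ⁅ e ⁆ ⟩
    r A + r ⁅ e ⁆   ≤⟨ +-mono-≤ (≤-refl {r A}) (≤-trans (rank-≤card M ⁅ e ⁆) (≤-reflexive (∣⁅x⁆∣≡1 e))) ⟩
    r A + 1         ≡⟨ +-comm (r A) 1 ⟩
    suc (r A)       ∎
    where open Data.Nat.Properties.≤-Reasoning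

  rank-absorb : ∀ {A B} → r (A ∪ B) ≡ r A → ∀ Y → r (Y ∪ (A ∪ B)) ≡ r (Y ∪ A)
  rank-absorb {A} {B} rA∪B≡rA Y = ≤-antisym (+-cancelʳ-≤ (r A) _ _ (begin
      r (Y ∪ (A ∪ B)) + r A              ≤⟨ +-mono-≤ (rank-mono M (∪-least (p⊆p∪q _ ∘ p⊆p∪q _) (q⊆p∪q _ _)))
                                                     (rank-mono M (λ x∈A → x∈p∩q⁺ (q⊆p∪q Y A x∈A , p⊆p∪q B x∈A))) ⟩
      r ((Y ∪ A) ∪ (A ∪ B)) + r ((Y ∪ A) ∩ (A ∪ B)) ≤⟨ rank-submod M (Y ∪ A) (A ∪ B) ⟩
      r (Y ∪ A) + r (A ∪ B)              ≡⟨ cong (r (Y ∪ A) +_) rA∪B≡rA ⟩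
      r (Y ∪ A) + r A                    ∎))
    (rank-mono M (∪-least (p⊆p∪q _) (q⊆p∪q Y _ ∘ p⊆p∪q B)))
    where open Data.Nat.Properties.≤-Reasoning

  minorRank-absorb : ∀ {A B} → r (A ∪ B) ≡ r A → ∀ Y → minorRank M (A ∪ B) Y ≡ minorRank M A Y
  minorRank-absorb rA∪B≡rA Y = cong₂ _∸_ (rank-absorb rA∪B≡rA Y) rA∪B≡rA

  minorRank-∪⁅⁆ : ∀ {A e} → r (A ∪ ⁅ e ⁆) ≡ suc (r A) → ∀ Y →
                  minorRank M A (Y ∪ ⁅ e ⁆) ≡ suc (minorRank M (A ∪ ⁅ e ⁆) Y)
  minorRank-∪⁅⁆ {A} {e} rA∪e≡1+rA Y = begin
    r ((Y ∪ ⁅ e ⁆) ∪ A) ∸ r A                 ≡⟨ cong (λ Z → r Z ∸ r A) reassociate ⟩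
    r (Y ∪ (A ∪ ⁅ e ⁆)) ∸ r A                 ≡⟨ m∸n≡1+[m∸1+n] _ (r A) rA<r[Y∪A∪e] ⟩
    suc (r (Y ∪ (A ∪ ⁅ e ⁆)) ∸ suc (r A))     ≡⟨ cong (λ x → suc (r (Y ∪ (A ∪ ⁅ e ⁆)) ∸ x)) (sym rA∪e≡1+rA) ⟩
    suc (r (Y ∪ (A ∪ ⁅ e ⁆)) ∸ r (A ∪ ⁅ e ⁆)) ∎
    where
    open ≡-Reasoning
    reassociate : (Y ∪ ⁅ e ⁆) ∪ A ≡ Y ∪ (A ∪ ⁅ e ⁆)
    reassociate = trans (∪-assoc Y ⁅ e ⁆ A) (cong (Y ∪_) (∪-comm ⁅ e ⁆ A))
    rA<r[Y∪A∪e] : r A < r (Y ∪ (A ∪ ⁅ e ⁆))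
    rA<r[Y∪A∪e] = ≤-trans (≤-reflexive (sym rA∪e≡1+rA)) (rank-mono M (q⊆p∪q Y _))

  minorRank-nonloop : ∀ {A e} → r (A ∪ ⁅ e ⁆) ≡ suc (r A) → minorRank M A ⁅ e ⁆ ≡ ∣ ⁅ e ⁆ ∣
  minorRank-nonloop {A} {e} rA∪e≡1+rA = begin
    r (⁅ e ⁆ ∪ A) ∸ r A ≡⟨ cong (λ Z → r Z ∸ r A) (∪-comm ⁅ e ⁆ A) ⟩
    r (A ∪ ⁅ e ⁆) ∸ r A ≡⟨ cong (_∸ r A) rA∪e≡1+rA ⟩
    suc (r A) ∸ r A     ≡⟨ m+n∸n≡m 1 (r A) ⟩
    1                   ≡⟨ sym (∣⁅x⁆∣≡1 e) ⟩
    ∣ ⁅ e ⁆ ∣           ∎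
    where open ≡-Reasoning

  minorRank-meeting-contraction : ∀ {A Y e} → e ∈ Y → e ∈ A → minorRank M A Y < ∣ Y ∣
  minorRank-meeting-contraction {A} {Y} {e} e∈Y e∈A =
    ≤-trans (s≤s (m≤n+o⇒m∸n≤o (r (Y ∪ A)) (r A) r[Y∪A]≤)) (x∈p⇒∣p-x∣<∣p∣ e∈Y)
    where
    Y∪A⊆ : Y ∪ A ⊆ (Y - e) ∪ A
    Y∪A⊆ = ∪-least move-e (q⊆p∪q _ A)
      where
      move-e : Y ⊆ (Y - e) ∪ A
      move-e {x} x∈Y with x ≟ᶠ e
      ... | yes refl = q⊆p∪q _ A e∈A
      ... | no  x≢e  = p⊆p∪q A (x∈p∧x≢y⇒x∈p-y x∈Y x≢e)
    r[Y∪A]≤ : r (Y ∪ A) ≤ r A + ∣ Y - e ∣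
    r[Y∪A]≤ = begin
      r (Y ∪ A)         ≤⟨ rank-mono M Y∪A⊆ ⟩
      r ((Y - e) ∪ A)   ≤⟨ rank-∪≤ (Y - e) A ⟩
      r (Y - e) + r A   ≤⟨ +-monoˡ-≤ (r A) (rank-≤card M (Y - e)) ⟩
      ∣ Y - e ∣ + r A   ≡⟨ +-comm ∣ Y - e ∣ (r A) ⟩
      r A + ∣ Y - e ∣   ∎
      where open Data.Nat.Properties.≤-Reasoning

  minorRank+rank : ∀ C X → minorRank M X C + r X ≡ r (C ∪ X)
  minorRank+rank C X = m∸n+n≡m (rank-mono M (q⊆p∪q C X))

  minorRank-antitone : ∀ C {X X′} → X ⊆ X′ → minorRank M X′ C ≤ minorRank M X C
  minorRank-antitone C {X} {X′} X⊆X′ = m≤n+o⇒m∸n≤o (r (C ∪ X′)) (r X′) (+-cancelʳ-≤ (r X) _ _ (begin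
    r (C ∪ X′) + r X                         ≤⟨ +-mono-≤ (rank-mono M (∪-least (p⊆p∪q X′ ∘ p⊆p∪q X) (q⊆p∪q _ X′)))
                                                         (rank-mono M (λ x∈X → x∈p∩q⁺ (q⊆p∪q C X x∈X , X⊆X′ x∈X))) ⟩
    r ((C ∪ X) ∪ X′) + r ((C ∪ X) ∩ X′)      ≤⟨ rank-submod M (C ∪ X) X′ ⟩
    r (C ∪ X) + r X′                         ≡⟨ cong (_+ r X′) (sym (minorRank+rank C X)) ⟩
    (minorRank M X C + r X) + r X′           ≡⟨ solve 3 (λ d a b → (d :+ a) :+ b := (b :+ d) :+ a) refl
                                                         (minorRank M X C) (r X) (r X′) ⟩
    (r X′ + minorRank M X C) + r X           ∎))
    where open Data.Nat.Properties.≤-Reasoning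

  -- If contracting X′ ⊇ X does not lower the rank of C below its rank in M / X, then C is skew to
  -- everything inside X′ in M / X, so contracting C as well does not change ranks there.
  minorRank-skew : ∀ C {X X′} → X ⊆ X′ → minorRank M X′ C ≡ minorRank M X C →
                   ∀ Y → Y ∪ X ⊆ X′ → minorRank M (C ∪ X) Y ≡ minorRank M X Y
  minorRank-skew C {X} {X′} X⊆X′ stall Y Y∪X⊆X′ = begin
    r (Y ∪ (C ∪ X)) ∸ r (C ∪ X)
      ≡⟨ cong₂ _∸_ r[Y∪C∪X] (sym (minorRank+rank C X)) ⟩
    (minorRank M X C + r (Y ∪ X)) ∸ (minorRank M X C + r X)
      ≡⟨ [m+n]∸[m+o]≡n∸o (minorRank M X C) (r (Y ∪ X)) (r X) ⟩
    r (Y ∪ X) ∸ r X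
      ∎
    where
    open ≡-Reasoning
    C-rank-unchanged : minorRank M (Y ∪ X) C ≡ minorRank M X C
    C-rank-unchanged = ≤-antisym (minorRank-antitone C (q⊆p∪q Y X))
      (≤-trans (≤-reflexive (sym stall)) (minorRank-antitone C Y∪X⊆X′))
    r[Y∪C∪X] : r (Y ∪ (C ∪ X)) ≡ minorRank M X C + r (Y ∪ X)
    r[Y∪C∪X] = begin
      r (Y ∪ (C ∪ X))                     ≡⟨ cong r (trans (sym (∪-assoc Y C X))
                                                   (trans (cong (_∪ X) (∪-comm Y C)) (∪-assoc C Y X))) ⟩
      r (C ∪ (Y ∪ X))                     ≡⟨ sym (minorRank+rank C (Y ∪ X)) ⟩
      minorRank M (Y ∪ X) C + r (Y ∪ X)   ≡⟨ cong (_+ r (Y ∪ X)) C-rank-unchanged ⟩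
      minorRank M X C + r (Y ∪ X)         ∎

module Representability {n} (q : ℕ) (M : Matroid n) where

  open MatroidRank M

  representable-⊆ : ∀ {A X X′} → X′ ⊆ X → Representable q M A X → Representable q M A X′
  representable-⊆ X′⊆X (F , d , v , rep) = F , d , v , λ Y Y⊆X′ → rep Y (X′⊆X ∘ Y⊆X′)

  representable-cong : ∀ {A A′ X} → (∀ Y → Y ⊆ X → minorRank M A Y ≡ minorRank M A′ Y) →
                       Representable q M A X → Representable q M A′ X
  representable-cong A≈A′ (F , d , v , rep) = F , d , v , λ Y Y⊆X →
    Product.map (_∘ trans (A≈A′ Y Y⊆X)) (trans (sym (A≈A′ Y Y⊆X)) ∘_) (rep Y Y⊆X)

  representable-contract-nonloop : ∀ {A X e} → e ∈ X → r (A ∪ ⁅ e ⁆) ≡ suc (r A) →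
    Representable q M A X → Representable q M (A ∪ ⁅ e ⁆) X
  representable-contract-nonloop {A} {X} {e} e∈X rA∪e≡1+rA (F , d , v , rep) = F , d , reduced , represents
    where
    open FieldLinearAlgebra F
    pivot : Σ (Fin d) λ j → v e j ≢ 0#
    pivot = linIndep⇒nonzero v (x∈⁅x⁆ e) (proj₁ (rep ⁅ e ⁆ (⁅x⁆⊆p e∈X)) (minorRank-nonloop rA∪e≡1+rA))
    pivot⁻¹ = inverse F (v e (proj₁ pivot)) (proj₂ pivot)
    open Pivot v e (proj₁ pivot) (proj₁ pivot⁻¹) (proj₂ pivot⁻¹)
    represents : ∀ Y → Y ⊆ X →
      (minorRank M (A ∪ ⁅ e ⁆) Y ≡ ∣ Y ∣ → LinIndep F reduced Y) ×
      (LinIndep F reduced Y → minorRank M (A ∪ ⁅ e ⁆) Y ≡ ∣ Y ∣)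
    represents Y Y⊆X with e ∈? Y
    ... | yes e∈Y = (λ indep → contradiction indep (<⇒≢ (minorRank-meeting-contraction e∈Y (q⊆p∪q A _ (x∈⁅x⁆ e)))))
                  , (λ li → contradiction li (¬linIndep-zero reduced e∈Y reduced-pivot≡0))
    ... | no  e∉Y = (linIndep-reduced e∉Y ∘ proj₁ rep-Y∪e ∘ to)
                  , (from ∘ proj₂ rep-Y∪e ∘ linIndep-unreduced e∉Y)
      where
      rep-Y∪e = rep (Y ∪ ⁅ e ⁆) (∪-least Y⊆X (⁅x⁆⊆p e∈X))
      rank-shift : minorRank M A (Y ∪ ⁅ e ⁆) ≡ suc (minorRank M (A ∪ ⁅ e ⁆) Y)
      rank-shift = minorRank-∪⁅⁆ rA∪e≡1+rA Y
      to : minorRank M (A ∪ ⁅ e ⁆) Y ≡ ∣ Y ∣ → minorRank M A (Y ∪ ⁅ e ⁆) ≡ ∣ Y ∪ ⁅ e ⁆ ∣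
      to indep = trans rank-shift (trans (cong suc indep) (sym (∣p∪⁅x⁆∣≡1+∣p∣ e Y e∉Y)))
      from : minorRank M A (Y ∪ ⁅ e ⁆) ≡ ∣ Y ∪ ⁅ e ⁆ ∣ → minorRank M (A ∪ ⁅ e ⁆) Y ≡ ∣ Y ∣
      from indep = suc-injective (trans (sym rank-shift) (trans indep (∣p∪⁅x⁆∣≡1+∣p∣ e Y e∉Y)))

  representable-contract : ∀ {A X e} → e ∈ X → Representable q M A X → Representable q M (A ∪ ⁅ e ⁆) X
  representable-contract {A} {X} {e} e∈X rep with m≤n⇒m<n∨m≡n (rank-mono M (p⊆p∪q {p = A} ⁅ e ⁆))
  ... | inj₂ rA≡rA∪e = representable-cong (λ Y _ → sym (minorRank-absorb (sym rA≡rA∪e) Y)) rep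
  ... | inj₁ rA<rA∪e = representable-contract-nonloop e∈X (≤-antisym (rank-∪⁅⁆≤ A e) rA<rA∪e) rep

  representable-addLoop : ∀ {A X e} → e ∈ A → Representable q M A X → Representable q M A (X ∪ ⁅ e ⁆)
  representable-addLoop {A} {X} {e} e∈A (F , d , v , rep) = F , d , v′ , represents
    where
    open FieldLinearAlgebra F
    v′ : Fin n → Fin d → Fin q
    v′ i j with i ≟ᶠ e
    ... | yes _ = 0#
    ... | no  _ = v i j
    v′ₑ≡0 : ∀ j → v′ e j ≡ 0#
    v′ₑ≡0 j with e ≟ᶠ e
    ... | yes _   = refl
    ... | no  e≢e = contradiction refl e≢e
    v≡v′ : ∀ i → i ≢ e → ∀ j → v i j ≡ v′ i j
    v≡v′ i i≢e j with i ≟ᶠ e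
    ... | yes i≡e = contradiction i≡e i≢e
    ... | no  _   = refl
    represents : ∀ Y → Y ⊆ X ∪ ⁅ e ⁆ →
      (minorRank M A Y ≡ ∣ Y ∣ → LinIndep F v′ Y) × (LinIndep F v′ Y → minorRank M A Y ≡ ∣ Y ∣)
    represents Y Y⊆ with e ∈? Y
    ... | yes e∈Y = (λ indep → contradiction indep (<⇒≢ (minorRank-meeting-contraction e∈Y e∈A)))
                  , (λ li → contradiction li (¬linIndep-zero v′ e∈Y v′ₑ≡0))
    ... | no  e∉Y = (linIndep-cong v≗v′ ∘ proj₁ rep-Y)
                  , (proj₂ rep-Y ∘ linIndep-cong (λ i i∈Y j → sym (v≗v′ i i∈Y j)))
      where
      ≢e : ∀ {i} → i ∈ Y → i ≢ e
      ≢e i∈Y refl = e∉Y i∈Y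
      Y⊆X : Y ⊆ X
      Y⊆X i∈Y = [ id , (λ i∈⁅e⁆ → contradiction (x∈⁅y⁆⇒x≡y e i∈⁅e⁆) (≢e i∈Y)) ]′ (x∈p∪q⁻ X ⁅ e ⁆ (Y⊆ i∈Y))
      rep-Y = rep Y Y⊆X
      v≗v′ : ∀ i → i ∈ Y → ∀ j → v i j ≡ v′ i j
      v≗v′ i i∈Y = v≡v′ i (≢e i∈Y)

  representable-contractAll : ∀ {A X} B → B ⊆ X → Representable q M A X → Representable q M (A ∪ B) X
  representable-contractAll {A} {X} =
    ∪⁅⁆-induction (λ B → B ⊆ X → Representable q M A X → Representable q M (A ∪ B) X)
    (λ _ → subst (λ A′ → Representable q M A′ X) (sym (∪-identityʳ A)))
    (λ S x ih S∪x⊆X → subst (λ A′ → Representable q M A′ X) (∪-assoc A S ⁅ x ⁆)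
                    ∘ representable-contract (S∪x⊆X (q⊆p∪q S _ (x∈⁅x⁆ x)))
                    ∘ ih (S∪x⊆X ∘ p⊆p∪q _))

  representable-addLoops : ∀ {A X} B → B ⊆ A → Representable q M A X → Representable q M A (X ∪ B)
  representable-addLoops {A} {X} =
    ∪⁅⁆-induction (λ B → B ⊆ A → Representable q M A X → Representable q M A (X ∪ B))
    (λ _ → subst (Representable q M A) (sym (∪-identityʳ X)))
    (λ S x ih S∪x⊆A → subst (Representable q M A) (∪-assoc X S ⁅ x ⁆)
                    ∘ representable-addLoop (S∪x⊆A (q⊆p∪q S _ (x∈⁅x⁆ x)))
                    ∘ ih (S∪x⊆A ∘ p⊆p∪q _))

  representable-minor : ∀ {A A′ X X′} → A ⊆ A′ → A′ ⊆ X ∪ A → X′ ⊆ X ∪ A →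
                        Representable q M A X → Representable q M A′ X′
  representable-minor {A} {A′} {X} A⊆A′ A′⊆X∪A X′⊆X∪A =
    representable-⊆ X′⊆X∪A
    ∘ subst (λ B → Representable q M B (X ∪ A)) (⊆-antisym (∪-least A⊆A′ id) (q⊆p∪q A A′))
    ∘ representable-contractAll A′ A′⊆X∪A
    ∘ representable-addLoops A id

isStack-unionUpTo : ∀ {n} q (M : Matroid n) C {k} (G : Fin k → Subset n) →
                 (∀ i j → i ≢ j → G i ∩ G j ≡ ⊥) →
                 (∀ i → ¬ Representable q M (C ∪ unionUpTo G (toℕ i)) (G i)) →
                 IsStack q k M C (unionUpTo G k)
isStack-unionUpTo {n} q M C {k} G disjoint nonrep =
  n , G , (λ i → ∈-unionUpTo⁺ G k i (toℕ<n i)) , disjoint , refl , λ i → minorRank≤n _ (G i) , nonrep i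
  where
  minorRank≤n : ∀ A Y → minorRank M A Y ≤ n
  minorRank≤n A Y = ≤-trans (m∸n≤m _ (rank M A)) (≤-trans (rank-≤card M (Y ∪ A)) (∣p∣≤n (Y ∪ A)))

module StackContraction {n} (q : ℕ) (M : Matroid n) (C : Subset n) {h} (F : Fin h → Subset n)
  (F-nonrep : ∀ i → ¬ Representable q M (⊥ ∪ unionUpTo F (toℕ i)) (F i)) where

  open MatroidRank M
  open Representability q M

  P : ℕ → Subset n
  P = unionUpTo F

  D : ℕ → ℕ
  D j = minorRank M (P j) C

  D-antitone : ∀ {j j′} → j ≤ j′ → D j′ ≤ D j
  D-antitone j≤j′ = minorRank-antitone C (unionUpTo-mono F j≤j′)

  C∪P₀≡C : C ∪ P 0 ≡ C
  C∪P₀≡C = trans (cong (C ∪_) (unionUpTo-zero F)) (∪-identityʳ C)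

  D₀≤rank : D 0 ≤ rank M C
  D₀≤rank = ≤-trans (m∸n≤m _ (r (P 0))) (≤-reflexive (cong r C∪P₀≡C))

  stalledBlock : ℕ → ℕ → Subset n
  stalledBlock ℓ m = P (suc m) ─ (C ∪ P ℓ)

  C∪Pℓ⊆C∪Pm : ∀ {ℓ m} → ℓ ≤ m → C ∪ P ℓ ⊆ C ∪ P m
  C∪Pℓ⊆C∪Pm ℓ≤m = ∪-least (p⊆p∪q _) (q⊆p∪q C _ ∘ unionUpTo-mono F ℓ≤m)

  C∪Pℓ∪stalledBlock : ∀ {ℓ m} → ℓ ≤ suc m → (C ∪ P ℓ) ∪ stalledBlock ℓ m ≡ C ∪ P (suc m)
  C∪Pℓ∪stalledBlock {ℓ} {m} ℓ≤1+m =
    ⊆-antisym (∪-least (C∪Pℓ⊆C∪Pm ℓ≤1+m) (q⊆p∪q C _ ∘ p─q⊆p _ _)) (∪-least (p⊆p∪q _ ∘ p⊆p∪q _) P[1+m]⊆)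
    where
    P[1+m]⊆ : P (suc m) ⊆ (C ∪ P ℓ) ∪ stalledBlock ℓ m
    P[1+m]⊆ {x} x∈ with x ∈? C ∪ P ℓ
    ... | yes x∈C∪Pℓ = p⊆p∪q _ x∈C∪Pℓ
    ... | no  x∉C∪Pℓ = q⊆p∪q _ _ (x∈p∧x∉q⇒x∈p─q x∈ x∉C∪Pℓ)

  stalledBlock-nonrep : ∀ {ℓ m} → m < h → ℓ ≤ m → D (suc m) ≡ D m →
                        ¬ Representable q M (C ∪ P ℓ) (stalledBlock ℓ m)
  stalledBlock-nonrep {ℓ} {m} m<h ℓ≤m stall rep = F-nonrep i (representable-cong contract-C rep-Fᵢ)
    where
    i = fromℕ< m<h
    Fᵢ⊆P[1+m] : F i ⊆ P (suc m)
    Fᵢ⊆P[1+m] = ∈-unionUpTo⁺ F (suc m) i (s≤s (≤-reflexive (toℕ-fromℕ< m<h)))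
    cover : P (suc m) ⊆ stalledBlock ℓ m ∪ (C ∪ P ℓ)
    cover x∈ = subst (_ ∈_) (trans (sym (C∪Pℓ∪stalledBlock (≤-trans ℓ≤m (n≤1+n m)))) (∪-comm _ _))
                     (q⊆p∪q C _ x∈)
    rep-Fᵢ : Representable q M (C ∪ P m) (F i)
    rep-Fᵢ = representable-minor (C∪Pℓ⊆C∪Pm ℓ≤m)
      (∪-least (q⊆p∪q _ _ ∘ p⊆p∪q (P ℓ)) (cover ∘ unionUpTo-mono F (n≤1+n m))) (cover ∘ Fᵢ⊆P[1+m]) rep
    contract-C : ∀ Y → Y ⊆ F i → minorRank M (C ∪ P m) Y ≡ minorRank M (⊥ ∪ unionUpTo F (toℕ i)) Y
    contract-C Y Y⊆Fᵢ = begin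
      minorRank M (C ∪ P m) Y                    ≡⟨ minorRank-skew C (unionUpTo-mono F (n≤1+n m)) stall Y
                                                      (∪-least (Fᵢ⊆P[1+m] ∘ Y⊆Fᵢ) (unionUpTo-mono F (n≤1+n m))) ⟩
      minorRank M (P m) Y                        ≡⟨ cong (λ B → minorRank M B Y)
                                                      (sym (trans (∪-identityˡ _) (cong P (toℕ-fromℕ< m<h)))) ⟩
      minorRank M (⊥ ∪ unionUpTo F (toℕ i)) Y    ∎
      where open ≡-Reasoning

  record Blocks (k ℓ : ℕ) : Set where
    field
      block          : Fin k → Subset n
      block-fresh    : ∀ i → block i ⊆ P h ─ (C ∪ P ℓ)
      block-disjoint : ∀ i j → i ≢ j → block i ∩ block j ≡ ⊥
      block-nonrep   : ∀ i → ¬ Representable q M ((C ∪ P ℓ) ∪ unionUpTo block (toℕ i)) (block i)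

  prepend : ∀ {k ℓ m} → m < h → ℓ ≤ m → D (suc m) ≡ D m → Blocks k (suc m) → Blocks (suc k) ℓ
  prepend {k} {ℓ} {m} m<h ℓ≤m stall G = record
    { block = block′ ; block-fresh = fresh ; block-disjoint = disjoint ; block-nonrep = nonrep }
    where
    open Blocks G
    ℓ≤1+m = ≤-trans ℓ≤m (n≤1+n m)
    block′ : Fin (suc k) → Subset n
    block′ zero    = stalledBlock ℓ m
    block′ (suc i) = block i
    fresh : ∀ i → block′ i ⊆ P h ─ (C ∪ P ℓ)
    fresh zero    = ─-mono (unionUpTo-mono F m<h) id
    fresh (suc i) = ─-mono id (C∪Pℓ⊆C∪Pm ℓ≤1+m) ∘ block-fresh i
    apart : ∀ j {x} → x ∈ stalledBlock ℓ m → x ∉ block j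
    apart j x∈₀ x∈ⱼ = x∈p─q⇒x∉q _ _ (block-fresh j x∈ⱼ) (q⊆p∪q C _ (p─q⊆p _ _ x∈₀))
    disjoint : ∀ i j → i ≢ j → block′ i ∩ block′ j ≡ ⊥
    disjoint zero    zero    0≢0 = contradiction refl 0≢0
    disjoint zero    (suc j) _   = disjoint⇒∩≡⊥ (apart j)
    disjoint (suc i) zero    _   = disjoint⇒∩≡⊥ (λ x∈ᵢ x∈₀ → apart i x∈₀ x∈ᵢ)
    disjoint (suc i) (suc j) i≢j = block-disjoint i j (i≢j ∘ cong suc)
    nonrep : ∀ i → ¬ Representable q M ((C ∪ P ℓ) ∪ unionUpTo block′ (toℕ i)) (block′ i)
    nonrep zero    = subst (λ A → ¬ Representable q M A (stalledBlock ℓ m)) (sym (∪-identityʳ _))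
                           (stalledBlock-nonrep m<h ℓ≤m stall)
    nonrep (suc i) = subst (λ A → ¬ Representable q M A (block i))
                           (sym (trans (sym (∪-assoc _ _ _)) (cong (_∪ _) (C∪Pℓ∪stalledBlock ℓ≤1+m))))
                           (block-nonrep i)

  -- Each new block spends at most D ℓ + 1 blocks of the stack before D stalls.
  blocks : ∀ k ℓ → ℓ + k * suc (D ℓ) ≤ h → Blocks k ℓ
  blocks zero    ℓ _    =
    record { block = λ () ; block-fresh = λ () ; block-disjoint = λ () ; block-nonrep = λ () }
  blocks (suc k) ℓ room with antitone-stalls D (λ j → D-antitone (n≤1+n j)) ℓ
  ... | m , ℓ≤m , m≤ℓ+Dℓ , stall = prepend m<h ℓ≤m stall (blocks k (suc m) room′)
    where
    open Data.Nat.Properties.≤-Reasoning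
    room′ : suc m + k * suc (D (suc m)) ≤ h
    room′ = begin
      suc m + k * suc (D (suc m))         ≤⟨ +-mono-≤ (s≤s m≤ℓ+Dℓ)
                                                       (*-monoʳ-≤ k (s≤s (D-antitone (≤-trans ℓ≤m (n≤1+n m))))) ⟩
      suc (ℓ + D ℓ) + k * suc (D ℓ)       ≡⟨ cong (_+ k * suc (D ℓ)) (sym (+-suc ℓ (D ℓ))) ⟩
      ℓ + suc (D ℓ) + k * suc (D ℓ)       ≡⟨ +-assoc ℓ (suc (D ℓ)) (k * suc (D ℓ)) ⟩
      ℓ + suc k * suc (D ℓ)               ≤⟨ room ⟩
      h                                   ∎
    m<h : m < h
    m<h = ≤-trans (m≤m+n (suc m) _) room′

  blocks⊆ : ∀ {Z k} → (∀ i → F i ⊆ Z) → (G : Blocks k 0) → unionUpTo (Blocks.block G) k ⊆ Z ─ C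
  blocks⊆ {k = k} F⊆Z G x∈ with ∈-unionUpTo⁻ (Blocks.block G) k x∈
  ... | i , _ , x∈Gᵢ with Blocks.block-fresh G i x∈Gᵢ
  ...   | x∈Pₕ─C∪P₀ with ∈-unionUpTo⁻ F h (p─q⊆p _ _ x∈Pₕ─C∪P₀)
  ...     | j , _ , x∈Fⱼ = x∈p∧x∉q⇒x∈p─q (F⊆Z j x∈Fⱼ) (x∈p─q⇒x∉q _ _ x∈Pₕ─C∪P₀ ∘ p⊆p∪q (P 0))

lemma3p1 : ∀ {n : ℕ} (q k : ℕ) → IsPrimePower q →
    (M : Matroid n) (C : Subset n) (Z : Subset n) →
    IsStack q (k * (rank M C + 1)) M ⊥ Z →
    Σ (Subset n) λ W → W ⊆ (Z ─ C) × IsStack q k M C W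
lemma3p1 q k _ M C Z (_ , F , F⊆Z , _ , _ , F-stack) =
  unionUpTo block k , blocks⊆ F⊆Z G , isStack-unionUpTo q M C block block-disjoint nonrep
  where
  open StackContraction q M C F (proj₂ ∘ F-stack)
  room : 0 + k * suc (D 0) ≤ k * (rank M C + 1)
  room = ≤-trans (*-monoʳ-≤ k (s≤s D₀≤rank)) (≤-reflexive (cong (k *_) (+-comm 1 (rank M C))))
  G = blocks k 0 room
  open Blocks G
  nonrep : ∀ i → ¬ Representable q M (C ∪ unionUpTo block (toℕ i)) (block i)
  nonrep i = subst (λ A → ¬ Representable q M A (block i)) (cong (_∪ unionUpTo block (toℕ i)) C∪P₀≡C)
                   (block-nonrep i)
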